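{- Let $\eta$ and $\theta$ be the morphisms on the free monoid over the alphabet $\{1,2,3\}$ defined by $$\eta(1)=123,\quad \eta(2)=12,\quad \eta(3)=123,$$ $$\theta(1)=312,\quad \theta(2)=12,\quad \theta(3)=312.$$ Let $x=x_1x_2x_3\cdots = 12312123123\cdots$ be the fixed point of $\eta$ starting with $1$ (the infinite word having every $\eta^n(1)$ as a prefix), and let $y=y_1y_2y_3\cdots=31231212312\cdots$ be the fixed point of $\theta$ starting with $3$ (the infinite word having every $\theta^n(3)$ as a prefix). Then $x$ is the left shift of $y$, i.e., $x_k=y_{k+1}$ for all $k\ge 1$.
   Context: A morphism on words over a finite alphabet is a map satisfying $\theta(uv)=\theta(u)\theta(v)$ for all finite words $u,v$; it is determined by the images of the letters. A fixed point of a morphism is an infinite word $w$ with $\theta(w)=w$, where $\theta$ is applied letter by letter. -}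

module Defs where

open import Data.Nat using (ℕ; zero; suc)
open import Data.Fin using (Fin; toℕ)
open import Data.List using (List; []; _∷_; concatMap; length; lookup)
open import Relation.Binary.PropositionalEquality using (_≡_)

data Letter : Set where
  one two three : Letter

-- Finite words and infinite words (0-indexed: w 0 is the first letter w₁).
Word : Set
Word = List Letter

InfWord : Set
InfWord = ℕ → Letter

extend : (Letter → Word) → Word → Word
extend f = concatMap f

iter : (Word → Word) → ℕ → Word → Word
iter g zero    u = u
iter g (suc n) u = g (iter g n u)

ηl : Letter → Word
ηl one   = one ∷ two ∷ three ∷ []
ηl two   = one ∷ two ∷ []
ηl three = one ∷ two ∷ three ∷ []

θl : Letter → Word
θl one   = three ∷ one ∷ two ∷ []
θl two   = one ∷ two ∷ []
θl three = three ∷ one ∷ two ∷ []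

η θ : Word → Word
η = extend ηl
θ = extend θl

IsPrefix : Word → InfWord → Set
IsPrefix u w = (i : Fin (length u)) → w (toℕ i) ≡ lookup u i

module Submission where

-- The fixed point x of η and the fixed point y of θ are related through the
-- conjugacy  12·θ(A) = η(A)·12,  valid for every finite word A.
--
-- Writing θ^{n+1}(3) = 3·Pₙ, the conjugacy gives by induction on n that
--   η^{n+1}(1) = Pₙ·3,
-- i.e. the word Pₙ is at once a prefix of x and (after dropping the leading 3)
-- a prefix of the shifted word y₂y₃⋯.  Two infinite words with a common prefix
-- agree on its positions, so x_k = y_{k+1} whenever k < |Pₙ|.  Since every
-- letter image of η has length at least 2, the lengths |η^n(1)| (and hence
-- |Pₙ| = |η^{n+1}(1)| - 1) grow without bound, which covers every k.

open import Defs
open import Data.Nat using (ℕ; zero; suc; _+_; _*_; _≤_; _<_; s≤s; z≤n)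
open import Data.Nat.Properties using (≤-trans; ≤-pred; +-mono-≤; +-comm; +-identityʳ; *-suc; *-zeroʳ)
open import Data.List using (List; []; _∷_; _++_; length; lookup)
open import Data.List.Properties using (++-assoc; length-++; concatMap-++)
open import Data.Fin using (Fin; toℕ; fromℕ<) renaming (zero to fzero; suc to fsuc)
open import Data.Fin.Properties using (toℕ-fromℕ<)
open import Data.Product using (Σ; _×_; _,_)
open import Relation.Binary.PropositionalEquality
  using (_≡_; refl; sym; trans; cong; subst; subst₂; module ≡-Reasoning)

prefix-++ : ∀ u v (w : InfWord) → IsPrefix (u ++ v) w → IsPrefix u w
prefix-++ (a ∷ u) v w p fzero    = p fzero
prefix-++ (a ∷ u) v w p (fsuc i) = prefix-++ u v (λ j → w (suc j)) (λ j → p (fsuc j)) i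

prefix-tail : ∀ a u (w : InfWord) → IsPrefix (a ∷ u) w → IsPrefix u (λ i → w (suc i))
prefix-tail a u w p i = p (fsuc i)

prefix-agree : ∀ u (w w′ : InfWord) → IsPrefix u w → IsPrefix u w′
  → (i : ℕ) → i < length u → w i ≡ w′ i
prefix-agree u w w′ p p′ i i<|u| = begin
    w i         ≡⟨ cong w (sym (toℕ-fromℕ< i<|u|)) ⟩
    w (toℕ j)   ≡⟨ p j ⟩
    lookup u j  ≡⟨ sym (p′ j) ⟩
    w′ (toℕ j)  ≡⟨ cong w′ (toℕ-fromℕ< i<|u|) ⟩
    w′ i        ∎
  where
  open ≡-Reasoning
  j : Fin (length u)
  j = fromℕ< i<|u|

extend-length : ∀ (f : Letter → Word) m → (∀ a → m ≤ length (f a))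
  → ∀ A → m * length A ≤ length (extend f A)
extend-length f m long [] = subst (_≤ 0) (sym (*-zeroʳ m)) z≤n
extend-length f m long (a ∷ A) = subst₂ _≤_ (sym (*-suc m (length A))) (sym (length-++ (f a)))
  (+-mono-≤ (long a) (extend-length f m long A))

-- Every image η(a) has length at least 2, so the iterates η^n(1) grow:
-- |η^n(1)| ≥ n + 1.
η-iterate-length : ∀ n → suc n ≤ length (iter η n (one ∷ []))
η-iterate-length zero    = s≤s z≤n
η-iterate-length (suc n) =
  ≤-trans (subst (suc (suc n) ≤_) (cong (ℓ +_) (sym (+-identityʳ ℓ))) (+-mono-≤ ℓ≥1 ih))
          (extend-length ηl 2 ηl-long (iter η n (one ∷ [])))
  where
  ℓ : ℕ
  ℓ = length (iter η n (one ∷ []))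
  ih : suc n ≤ ℓ
  ih = η-iterate-length n
  ℓ≥1 : 1 ≤ ℓ
  ℓ≥1 = ≤-trans (s≤s z≤n) ih
  ηl-long : ∀ a → 2 ≤ length (ηl a)
  ηl-long one   = s≤s (s≤s z≤n)
  ηl-long two   = s≤s (s≤s z≤n)
  ηl-long three = s≤s (s≤s z≤n)

conjugacy : ∀ A → one ∷ two ∷ θ A ≡ η A ++ one ∷ two ∷ []
conjugacy []          = refl
conjugacy (one ∷ A)   = cong (λ u → one ∷ two ∷ three ∷ u) (conjugacy A)
conjugacy (two ∷ A)   = cong (λ u → one ∷ two ∷ u) (conjugacy A)
conjugacy (three ∷ A) = cong (λ u → one ∷ two ∷ three ∷ u) (conjugacy A)

η-snoc-three : ∀ P → η (P ++ three ∷ []) ≡ (one ∷ two ∷ θ P) ++ three ∷ []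
η-snoc-three P = begin
  η (P ++ three ∷ [])                         ≡⟨ concatMap-++ ηl P (three ∷ []) ⟩
  η P ++ one ∷ two ∷ three ∷ []               ≡⟨ sym (++-assoc (η P) (one ∷ two ∷ []) (three ∷ [])) ⟩
  (η P ++ one ∷ two ∷ []) ++ three ∷ []       ≡⟨ cong (_++ three ∷ []) (sym (conjugacy P)) ⟩
  (one ∷ two ∷ θ P) ++ three ∷ []             ∎
  where open ≡-Reasoning

common-prefix : ∀ n → Σ Word λ P
  → (iter θ (suc n) (three ∷ []) ≡ three ∷ P) × (iter η (suc n) (one ∷ []) ≡ P ++ three ∷ [])
common-prefix zero = one ∷ two ∷ [] , refl , refl
common-prefix (suc n) with common-prefix n
... | P , θ-eq , η-eq = one ∷ two ∷ θ P , cong θ θ-eq , trans (cong η η-eq) (η-snoc-three P)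

proposition5 : (x y : InfWord)
    → ((n : ℕ) → IsPrefix (iter η n (one ∷ [])) x)
    → ((n : ℕ) → IsPrefix (iter θ n (three ∷ [])) y)
    → (k : ℕ) → x k ≡ y (suc k)
proposition5 x y x-prefix y-prefix k with common-prefix k
... | P , θ-eq , η-eq = prefix-agree P x (λ i → y (suc i)) P-prefix-x P-prefix-y k k<|P|
  where
  P-prefix-x : IsPrefix P x
  P-prefix-x = prefix-++ P (three ∷ []) x (subst (λ u → IsPrefix u x) η-eq (x-prefix (suc k)))
  P-prefix-y : IsPrefix P (λ i → y (suc i))
  P-prefix-y = prefix-tail three P y (subst (λ u → IsPrefix u y) θ-eq (y-prefix (suc k)))
  |P·3|≡1+|P| : length (P ++ three ∷ []) ≡ suc (length P)
  |P·3|≡1+|P| = trans (length-++ P) (+-comm (length P) 1)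
  k<|P| : k < length P
  k<|P| = ≤-pred (subst (suc (suc k) ≤_) (trans (cong length η-eq) |P·3|≡1+|P|)
                                          (η-iterate-length (suc k)))
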